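{- Let \(G=(V,E)\) be a connected undirected graph with no loops or parallel edges, \(n=|V|\ge 4\), \(m=|E|\), and positive edge costs \(c\in\mathbb{R}_{>0}^E\). Then the layer graphs \(G_0,G_1,\dots,G_L\) of \(G\) (defined in the context) have \(O(m\log n)\) edges and vertices in total.
   Context: \(\delta(u,v)\) denotes the shortest-path distance in \(G\) with respect to \(c\), and \(\lg=\log_2\). Layers and reaches: pick an arbitrary vertex \(s\) of \(G\); let \(x,y\) be the two vertices farthest from \(s\), and set \(\Delta_0=\delta(s,x)+\delta(s,y)\). For a reach \(\Delta_i\), the layer \(G_i=(V_i,E_i)\) is the graph obtained from \(G\) by contracting every edge of cost at most \(\Delta_i/n\), deleting every edge of cost strictly greater than \(2\Delta_i\), and removing all vertices left isolated. Given \(\Delta_{i-1}\): if \(G_{i-1}\) contains at least one edge, then \(\Delta_i=\Delta_{i-1}/2\); otherwise let \(e\) be an edge of \(G\) of maximum cost among those with \(c(e)\le\Delta_{i-1}/n\); if such an edge exists, set \(\Delta_i=n\,c(e)/2\), and if it does not exist, the sequence stops and \(L=i-1\).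
   Formalization: The edge costs take positive rational values instead of positive real ones, so the shortest-path distances δ and the reaches Δ_i are rational too. -}

module Defs where

open import Data.Nat using (ℕ; zero; suc; _≤_) renaming (_+_ to _+ℕ_)
open import Data.Integer using (+_)
open import Data.Rational using (ℚ; _/_; 0ℚ; ½; _+_; _*_) renaming (_≤_ to _≤ℚ_; _<_ to _<ℚ_)
open import Data.Rational.Properties using () renaming (_≤?_ to _≤ℚ?_; _<?_ to _<ℚ?_)
open import Data.Fin using (Fin)
open import Data.Fin.Properties using (any?) renaming (_≟_ to _≟F_)
open import Data.List using (List; length; filter; map; upTo)
open import Data.Nat.ListAction using (sum)
open import Data.List.Base using ()
open import Data.Fin.Base using ()
open import Data.Product using (Σ; ∃; _×_; _,_; proj₁; proj₂; swap)
open import Data.Sum using (_⊎_)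
open import Data.Unit using (⊤)
open import Data.Empty using (⊥)
open import Relation.Nullary using (¬_; Dec)
open import Relation.Nullary.Decidable using (_×-dec_; _⊎-dec_; ¬?)
open import Relation.Binary.PropositionalEquality using (_≡_; _≢_)
open import Relation.Binary.Construct.Closure.ReflexiveTransitive using (Star)
open import Function.Bundles using (_⇔_)
import Data.List as L
import Data.Fin as F

ℕℚ : ℕ → ℚ
ℕℚ k = + k / 1

countFin : {k : ℕ} {P : Fin k → Set} → ((i : Fin k) → Dec (P i)) → ℕ
countFin {k} P? = length (filter P? (L.allFin k))

record Graph : Set where
  field
    n    : ℕ
    m    : ℕ
    ends : Fin m → Fin n × Fin n
    cost : Fin m → ℚ

module _ (G : Graph) where
  open Graph G

  Joins : Fin m → Fin n → Fin n → Set
  Joins e u v = (ends e ≡ (u , v)) ⊎ (ends e ≡ (v , u))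

  Simple : Set
  Simple = (∀ e → proj₁ (ends e) ≢ proj₂ (ends e))
         × (∀ e f → Joins f (proj₁ (ends e)) (proj₂ (ends e)) → e ≡ f)

  PositiveCosts : Set
  PositiveCosts = ∀ e → 0ℚ <ℚ cost e

  Adj : (Fin m → Set) → Fin n → Fin n → Set
  Adj P u v = Σ (Fin m) λ e → P e × Joins e u v

  Connected : Set
  Connected = ∀ u v → Star (Adj (λ _ → ⊤)) u v

  data Walk : Fin n → Fin n → ℚ → Set where
    nil  : ∀ {u} → Walk u u 0ℚ
    cons : ∀ {u w v d} (e : Fin m) → Joins e u w → Walk w v d → Walk u v (cost e + d)

  IsDist : Fin n → Fin n → ℚ → Set
  IsDist u v d = Walk u v d × (∀ d' → Walk u v d' → d ≤ℚ d')

  TwoFarthest : (Fin n → ℚ) → Fin n → Fin n → Set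
  TwoFarthest dist x y =
    x ≢ y × (∀ z → z ≢ x → z ≢ y → (dist z ≤ℚ dist x) × (dist z ≤ℚ dist y))

  -- edge e is contracted in the layer of reach Δ : c(e) ≤ Δ/n
  Cheap : ℚ → Fin m → Set
  Cheap Δ e = ℕℚ n * cost e ≤ℚ Δ

  -- the result of contracting all edges of cost ≤ Δ/n:
  -- a surjection π onto Fin k identifying exactly the vertices connected by cheap edges
  record Contraction (Δ : ℚ) : Set where
    field
      k       : ℕ
      π       : Fin n → Fin k
      surj    : ∀ w → Σ (Fin n) λ v → π v ≡ w
      classes : ∀ u v → (π u ≡ π v) ⇔ Star (Adj (Cheap Δ)) u v

  module _ {Δ : ℚ} (C : Contraction Δ) where
    open Contraction C

    -- edge e survives in the layer G_Δ: not contracted (Δ/n < c(e)),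
    -- not deleted (c(e) ≤ 2Δ), and not turned into a loop by the contraction
    InLayer : Fin m → Set
    InLayer e = (Δ <ℚ ℕℚ n * cost e) × (cost e ≤ℚ ℕℚ 2 * Δ)
              × (π (proj₁ (ends e)) ≢ π (proj₂ (ends e)))

    inLayer? : ∀ e → Dec (InLayer e)
    inLayer? e = (Δ <ℚ? ℕℚ n * cost e) ×-dec (cost e ≤ℚ? ℕℚ 2 * Δ)
               ×-dec ¬? (π (proj₁ (ends e)) ≟F π (proj₂ (ends e)))

    NonIsolated : Fin k → Set
    NonIsolated w = ∃ λ e → InLayer e × ((π (proj₁ (ends e)) ≡ w) ⊎ (π (proj₂ (ends e)) ≡ w))

    nonIsolated? : ∀ w → Dec (NonIsolated w)
    nonIsolated? w = any? λ e → inLayer? e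
                       ×-dec ((π (proj₁ (ends e)) ≟F w) ⊎-dec (π (proj₂ (ends e)) ≟F w))

    layerEdges : ℕ
    layerEdges = countFin inLayer?

    layerVertices : ℕ
    layerVertices = countFin nonIsolated?

    HasEdge : Set
    HasEdge = ∃ λ e → InLayer e

  NextReach : {Δ : ℚ} → Contraction Δ → ℚ → Set
  NextReach {Δ} C Δ' =
      (HasEdge C × Δ' ≡ Δ * ½)
    ⊎ (¬ HasEdge C × Σ (Fin m) λ e → Cheap Δ e × (∀ f → Cheap Δ f → cost f ≤ℚ cost e)
                                     × Δ' ≡ ℕℚ n * cost e * ½)

  Stops : {Δ : ℚ} → Contraction Δ → Set
  Stops {Δ} C = ¬ HasEdge C × (∀ e → ¬ Cheap Δ e)

  IsLayerSequence : ℚ → (Δ : ℕ → ℚ) → ((i : ℕ) → Contraction (Δ i)) → ℕ → Set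
  IsLayerSequence Δ₀ Δ C L =
      (Δ 0 ≡ Δ₀)
    × (∀ i → suc i ≤ L → NextReach (C i) (Δ (suc i)))
    × Stops (C L)

  totalSize : (Δ : ℕ → ℚ) → ((i : ℕ) → Contraction (Δ i)) → ℕ → ℕ
  totalSize Δ C L = sum (map (λ i → layerVertices (C i) +ℕ layerEdges (C i)) (upTo (suc L)))

module Submission where

-- A layer edge e satisfies c(e)/2 ≤ Δᵢ < n·c(e), and the reaches at least halve from one layer to
-- the next. A halving sequence enters a window [lo, r·lo) at most 1 + ⌊lg r⌋ times, so e lies in at
-- most 2 + ⌊lg n⌋ layers and, double counting, Σᵢ |Eᵢ| ≤ m (2 + ⌊lg n⌋). Each vertex of a layer is
-- an endpoint of one of its edges, so |Vᵢ| ≤ 2 |Eᵢ|, and the total is at most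
-- 3m (2 + ⌊lg n⌋) ≤ 6m ⌊lg n⌋ once n ≥ 4.

module Counting where

  open import Defs using (countFin)
  open import Data.Bool.Base using (true; false; if_then_else_)
  open import Data.Fin.Base using (Fin; zero; suc; toℕ)
  open import Data.Fin.Properties using (_≟_)
  open import Data.List.Base using (length; filter; tabulate; applyUpTo)
  open import Data.Nat.Base
  open import Data.Nat.ListAction using (sum)
  open import Data.Nat.Properties hiding (_≟_)
  open import Algebra.Properties.Semiring.Sum +-*-semiring using (sum-syntax; sum-remove; sum-replicate-zero; sum-cong-≗; ∑-comm; ∑-distrib-+; *-distribˡ-sum; *-distribʳ-sum)
  open import Data.Product using (∃-syntax; _×_; _,_)
  open import Data.Sum using (_⊎_; inj₁; inj₂)
  open import Function using (id; _∘_)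
  open import Relation.Binary.PropositionalEquality
  open import Relation.Nullary using (Dec; yes; no; does; contradiction)

  -- Through does, so that 𝟙 (Dec.map′ f g p?) reduces to 𝟙 p?.
  𝟙 : {P : Set} → Dec P → ℕ
  𝟙 p? = if does p? then 1 else 0

  𝟙-yes : {P : Set} (p? : Dec P) → P → 𝟙 p? ≡ 1
  𝟙-yes (yes _) _ = refl
  𝟙-yes (no ¬p) p = contradiction p ¬p

  𝟙-mono : {P Q : Set} → (P → Q) → (p? : Dec P) (q? : Dec Q) → 𝟙 p? ≤ 𝟙 q?
  𝟙-mono _   (no _)  _       = z≤n
  𝟙-mono _   (yes _) (yes _) = ≤-refl
  𝟙-mono P⇒Q (yes p) (no ¬q) = contradiction (P⇒Q p) ¬q

  ∑-mono-≤ : ∀ {n} {f g : Fin n → ℕ} → (∀ i → f i ≤ g i) → ∑[ i < n ] f i ≤ ∑[ i < n ] g i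
  ∑-mono-≤ {zero}  _   = z≤n
  ∑-mono-≤ {suc n} f≤g = +-mono-≤ (f≤g zero) (∑-mono-≤ (f≤g ∘ suc))

  ∑-≤-* : ∀ {n b} {f : Fin n → ℕ} → (∀ i → f i ≤ b) → ∑[ i < n ] f i ≤ n * b
  ∑-≤-* {zero}  _   = z≤n
  ∑-≤-* {suc n} f≤b = +-mono-≤ (f≤b zero) (∑-≤-* (f≤b ∘ suc))

  ≤-∑ : ∀ {n} (t : Fin n → ℕ) i → t i ≤ ∑[ j < n ] t j
  ≤-∑ {suc n} t i = ≤-trans (m≤m+n (t i) _) (≤-reflexive (sym (sum-remove {i = i} t)))

  ∑-𝟙-≟ : ∀ {n} (a : Fin n) → ∑[ i < n ] 𝟙 (a ≟ i) ≡ 1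
  ∑-𝟙-≟ {suc n} zero    = cong suc (sum-replicate-zero n)
  ∑-𝟙-≟ {suc n} (suc a) = ∑-𝟙-≟ a

  length-filter-tabulate : ∀ {A : Set} {P : A → Set} (P? : ∀ x → Dec (P x)) {n} (f : Fin n → A) →
                           length (filter P? (tabulate f)) ≡ ∑[ i < n ] 𝟙 (P? (f i))
  length-filter-tabulate P? {zero}  f = refl
  length-filter-tabulate P? {suc n} f with does (P? (f zero))
  ... | true  = cong suc (length-filter-tabulate P? (f ∘ suc))
  ... | false = length-filter-tabulate P? (f ∘ suc)

  countFin≡∑𝟙 : ∀ {n} {P : Fin n → Set} (P? : ∀ i → Dec (P i)) → countFin P? ≡ ∑[ i < n ] 𝟙 (P? i)
  countFin≡∑𝟙 P? = length-filter-tabulate P? id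

  sum-applyUpTo : ∀ (f : ℕ → ℕ) n → sum (applyUpTo f n) ≡ ∑[ i < n ] f (toℕ i)
  sum-applyUpTo f zero    = refl
  sum-applyUpTo f (suc n) = cong (f 0 +_) (sum-applyUpTo (f ∘ suc) n)

  countFin-endpoints-≤ : ∀ {k m} {P : Fin k → Set} {Q : Fin m → Set}
                         (P? : ∀ w → Dec (P w)) (Q? : ∀ e → Dec (Q e)) (f g : Fin m → Fin k) →
                         (∀ w → P w → ∃[ e ] Q e × (f e ≡ w ⊎ g e ≡ w)) →
                         countFin P? ≤ 2 * countFin Q?
  countFin-endpoints-≤ {k} {m} P? Q? f g covered = begin
    countFin P?                                    ≡⟨ countFin≡∑𝟙 P? ⟩
    ∑[ w < k ] 𝟙 (P? w)                            ≤⟨ ∑-mono-≤ hit ⟩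
    ∑[ w < k ] ∑[ e < m ] (𝟙 (Q? e) * ends e w)    ≡⟨ ∑-comm (λ w e → 𝟙 (Q? e) * ends e w) ⟩
    ∑[ e < m ] ∑[ w < k ] (𝟙 (Q? e) * ends e w)    ≡⟨ sum-cong-≗ per-edge ⟩
    ∑[ e < m ] (𝟙 (Q? e) * 2)                      ≡⟨ *-distribʳ-sum 2 (λ e → 𝟙 (Q? e)) ⟨
    (∑[ e < m ] 𝟙 (Q? e)) * 2                      ≡⟨ *-comm (∑[ e < m ] 𝟙 (Q? e)) 2 ⟩
    2 * ∑[ e < m ] 𝟙 (Q? e)                        ≡⟨ cong (2 *_) (countFin≡∑𝟙 Q?) ⟨
    2 * countFin Q?                                ∎
    where
    open ≤-Reasoning

    ends : Fin m → Fin k → ℕ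
    ends e w = 𝟙 (f e ≟ w) + 𝟙 (g e ≟ w)

    per-edge : ∀ e → ∑[ w < k ] (𝟙 (Q? e) * ends e w) ≡ 𝟙 (Q? e) * 2
    per-edge e = begin-equality
      ∑[ w < k ] (𝟙 (Q? e) * ends e w)                ≡⟨ *-distribˡ-sum (𝟙 (Q? e)) (ends e) ⟨
      𝟙 (Q? e) * ∑[ w < k ] ends e w
        ≡⟨ cong (𝟙 (Q? e) *_) (∑-distrib-+ (λ w → 𝟙 (f e ≟ w)) (λ w → 𝟙 (g e ≟ w))) ⟩
      𝟙 (Q? e) * (∑[ w < k ] 𝟙 (f e ≟ w) + ∑[ w < k ] 𝟙 (g e ≟ w))
        ≡⟨ cong (𝟙 (Q? e) *_) (cong₂ _+_ (∑-𝟙-≟ (f e)) (∑-𝟙-≟ (g e))) ⟩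
      𝟙 (Q? e) * 2                                    ∎

    endpoint : ∀ {e w} → f e ≡ w ⊎ g e ≡ w → 1 ≤ ends e w
    endpoint {e} {w} (inj₁ fe≡w) = ≤-trans (≤-reflexive (sym (𝟙-yes (f e ≟ w) fe≡w))) (m≤m+n _ _)
    endpoint {e} {w} (inj₂ ge≡w) = ≤-trans (≤-reflexive (sym (𝟙-yes (g e ≟ w) ge≡w))) (m≤n+m _ _)

    hit : ∀ w → 𝟙 (P? w) ≤ ∑[ e < m ] (𝟙 (Q? e) * ends e w)
    hit w with P? w
    ... | no _  = z≤n
    ... | yes p with covered w p
    ...   | e , q , at-end = begin
      1                                 ≤⟨ endpoint at-end ⟩
      ends e w                          ≡⟨ *-identityˡ (ends e w) ⟨
      1 * ends e w                      ≡⟨ cong (_* ends e w) (𝟙-yes (Q? e) q) ⟨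
      𝟙 (Q? e) * ends e w               ≤⟨ ≤-∑ (λ e → 𝟙 (Q? e) * ends e w) e ⟩
      ∑[ e < m ] (𝟙 (Q? e) * ends e w)  ∎

module HalvingSequences where

  open import Defs using (ℕℚ)
  open Counting using (𝟙)
  open import Data.Empty using (⊥-elim)
  open import Data.Fin.Base using (toℕ)
  open import Data.Integer.Base using (+_; +≤+)
  import Data.Integer.Properties as ℤ
  open import Data.Nat.Base as ℕ using (ℕ; zero; suc; _^_; s<s; z<s)
  import Data.Nat.Properties as ℕ
  open import Algebra.Properties.Semiring.Sum ℕ.+-*-semiring using (sum-syntax)
  open import Data.Nat.Coprimality using (1-coprimeTo) renaming (sym to coprime-sym)
  open import Data.Nat.Logarithm using (⌊log₂_⌋; ⌊log₂⌋-mono-≤; ⌊log₂[2^n]⌋≡n)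
  open import Data.Product using (_×_; _,_)
  open import Data.Rational.Base
  open import Data.Rational.Properties
  open import Data.Rational.Solver using (module +-*-Solver)
  open import Data.Sum as Sum using (_⊎_; inj₁; inj₂)
  open import Data.Unit using (tt)
  open import Function using (_∘_; id)
  open import Relation.Binary.PropositionalEquality
  open import Relation.Nullary using (Dec; yes; no)
  open import Relation.Nullary.Decidable using (_×-dec_)

  n<2^[1+⌊log₂n⌋] : ∀ n → n ℕ.< 2 ^ suc ⌊log₂ n ⌋
  n<2^[1+⌊log₂n⌋] n = ℕ.≰⇒> λ 2^[1+⌊log₂n⌋]≤n →
    ℕ.<-irrefl refl (subst (ℕ._≤ ⌊log₂ n ⌋) (⌊log₂[2^n]⌋≡n (suc ⌊log₂ n ⌋))
                           (⌊log₂⌋-mono-≤ 2^[1+⌊log₂n⌋]≤n))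

  ℕℚ≡mkℚ : ∀ a → ℕℚ a ≡ mkℚ (+ a) 0 (coprime-sym (1-coprimeTo a))
  ℕℚ≡mkℚ a = normalize-coprime _

  ℕℚ-homo-* : ∀ a b → ℕℚ (a ℕ.* b) ≡ ℕℚ a * ℕℚ b
  ℕℚ-homo-* a b rewrite ℕℚ≡mkℚ a | ℕℚ≡mkℚ b = cong (_/ 1) (ℤ.pos-* a b)

  ℕℚ-mono-≤ : ∀ {a b} → a ℕ.≤ b → ℕℚ a ≤ ℕℚ b
  ℕℚ-mono-≤ {a} {b} a≤b rewrite ℕℚ≡mkℚ a | ℕℚ≡mkℚ b = *≤* (ℤ.*-monoʳ-≤-nonNeg (+ 1) (+≤+ a≤b))

  ℕℚ-nonNeg : ∀ a → NonNegative (ℕℚ a)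
  ℕℚ-nonNeg a = normalize-nonNeg a 1

  p<q⇒p*½<q : ∀ {p q} → 0ℚ ≤ q → p < q → p * ½ < q
  p<q⇒p*½<q {p} {q} 0≤q p<q = begin-strict
    p * ½   <⟨ *-monoˡ-<-pos ½ p<q ⟩
    q * ½   ≤⟨ *-monoˡ-≤-nonNeg q {{nonNegative 0≤q}} (≤ᵇ⇒≤ tt) ⟩
    q * 1ℚ  ≡⟨ *-identityʳ q ⟩
    q       ∎
    where open ≤-Reasoning

  module _ (lo hi : ℚ) where

    InWindow : ℚ → Set
    InWindow d = lo ≤ d × d < hi

    inWindow? : ∀ d → Dec (InWindow d)
    inWindow? d = lo ≤? d ×-dec d <? hi

    visits : (ℕ → ℚ) → ℕ → ℕ
    visits D N = ∑[ j < N ] 𝟙 (inWindow? (D (toℕ j)))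

  -- N halving steps, relating the N + 1 terms D 0, …, D N.
  Halving : (ℕ → ℚ) → ℕ → Set
  Halving D N = ∀ j → j ℕ.< N → D (suc j) ≤ D j * ½

  module _ {lo hi : ℚ} (0≤lo : 0ℚ ≤ lo) where

    private
      0≤2^k·lo : ∀ k → 0ℚ ≤ ℕℚ (2 ^ k) * lo
      0≤2^k·lo k = subst (_≤ ℕℚ (2 ^ k) * lo) (*-zeroʳ (ℕℚ (2 ^ k)))
                         (*-monoˡ-≤-nonNeg (ℕℚ (2 ^ k)) {{ℕℚ-nonNeg (2 ^ k)}} 0≤lo)

      2^[1+k]·lo*½ : ∀ k → ℕℚ (2 ^ suc k) * lo * ½ ≡ ℕℚ (2 ^ k) * lo
      2^[1+k]·lo*½ k = trans (cong (λ x → x * lo * ½) (ℕℚ-homo-* 2 (2 ^ k)))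
        (solve 2 (λ x l → con (ℕℚ 2) :* x :* l :* con ½ := x :* l) refl (ℕℚ (2 ^ k)) lo)
        where open +-*-Solver

    -- A term in the window lies below 2ᵏ·lo, so every later term lies below 2ᵏ⁻¹·lo: the second
    -- alternative carries this ceiling through the induction. The tail is bounded through D 0 * ½
    -- because Halving D N constrains D 1 only when N > 0.
    visits-≤ : ∀ N D k → Halving D N → hi ≤ ℕℚ (2 ^ k) * lo ⊎ D 0 < ℕℚ (2 ^ k) * lo →
               visits lo hi D (suc N) ℕ.≤ k
    visits-tail-≤ : ∀ N D k → Halving D N → hi ≤ ℕℚ (2 ^ k) * lo ⊎ D 0 * ½ < ℕℚ (2 ^ k) * lo →
                    visits lo hi (D ∘ suc) N ℕ.≤ k

    visits-≤ N D k halving ceiling = first-term (inWindow? lo hi (D 0))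
      where
      first-term : (D₀∈? : Dec (InWindow lo hi (D 0))) → 𝟙 D₀∈? ℕ.+ visits lo hi (D ∘ suc) N ℕ.≤ k
      first-term (no _)                =
        visits-tail-≤ N D k halving (Sum.map₂ (p<q⇒p*½<q (0≤2^k·lo k)) ceiling)
      first-term (yes (lo≤D₀ , D₀<hi)) = in-window k (Sum.[ <-≤-trans D₀<hi , id ] ceiling)
        where
        in-window : ∀ k → D 0 < ℕℚ (2 ^ k) * lo → suc (visits lo hi (D ∘ suc) N) ℕ.≤ k
        in-window zero    D₀<lo =
          ⊥-elim (<-irrefl refl (≤-<-trans lo≤D₀ (subst (D 0 <_) (*-identityˡ lo) D₀<lo)))
        in-window (suc k) D₀<2^[1+k]·lo = ℕ.s≤s (visits-tail-≤ N D k halving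
          (inj₂ (subst (D 0 * ½ <_) (2^[1+k]·lo*½ k) (*-monoˡ-<-pos ½ D₀<2^[1+k]·lo))))

    visits-tail-≤ zero    D k _       _       = ℕ.z≤n
    visits-tail-≤ (suc N) D k halving ceiling =
      visits-≤ N (D ∘ suc) k (λ j j<N → halving (suc j) (s<s j<N))
               (Sum.map₂ (≤-<-trans (halving 0 z<s)) ceiling)

    visits-≤-1+⌊log₂⌋ : ∀ {N D} r → Halving D N → hi ≤ ℕℚ r * lo →
                        visits lo hi D (suc N) ℕ.≤ suc ⌊log₂ r ⌋
    visits-≤-1+⌊log₂⌋ {N} {D} r halving hi≤r·lo = visits-≤ N D (suc ⌊log₂ r ⌋) halving (inj₁ (begin
      hi                          ≤⟨ hi≤r·lo ⟩
      ℕℚ r * lo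
        ≤⟨ *-monoʳ-≤-nonNeg lo {{nonNegative 0≤lo}} (ℕℚ-mono-≤ (ℕ.<⇒≤ (n<2^[1+⌊log₂n⌋] r))) ⟩
      ℕℚ (2 ^ suc ⌊log₂ r ⌋) * lo ∎))
      where open ≤-Reasoning

module LayerSizes where

  open import Defs
  open Counting
  open HalvingSequences
  open import Data.Fin.Base using (Fin; toℕ)
  open import Data.List.Base using (applyUpTo)
  open import Data.List.Properties using (map-upTo)
  open import Data.Nat.Base
  open import Data.Nat.ListAction using (sum)
  open import Data.Nat.Logarithm using (⌊log₂_⌋; ⌊log₂[2*b]⌋≡1+⌊log₂b⌋)
  open import Data.Nat.Properties
  open import Data.Nat.Solver using (module +-*-Solver)
  open import Algebra.Properties.Semiring.Sum +-*-semiring using (sum-syntax; sum-cong-≗; ∑-comm; *-distribˡ-sum)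
  open import Data.Product using (_,_; proj₁; proj₂)
  open import Data.Rational.Base as ℚ using (0ℚ; ½)
  import Data.Rational.Properties as ℚ
  import Data.Rational.Solver as ℚ
  open import Data.Sum using (inj₁; inj₂)
  open import Function using (_∘_)
  open import Relation.Binary.PropositionalEquality

  ℕℚ[2n]*c/2≡ℕℚn*c : ∀ n c → ℕℚ (2 * n) ℚ.* (c ℚ.* ½) ≡ ℕℚ n ℚ.* c
  ℕℚ[2n]*c/2≡ℕℚn*c n c = trans (cong (ℚ._* (c ℚ.* ½)) (ℕℚ-homo-* 2 n))
    (solve 2 (λ n c → con (ℕℚ 2) :* n :* (c :* con ½) := n :* c) refl (ℕℚ n) c)
    where open ℚ.+-*-Solver

  3*[m*[2+l]]≤6*m*l : ∀ m {l} → 2 ≤ l → 3 * (m * (2 + l)) ≤ 6 * m * l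
  3*[m*[2+l]]≤6*m*l m {l} 2≤l = begin
    3 * (m * (2 + l)) ≤⟨ *-monoʳ-≤ 3 (*-monoʳ-≤ m (+-monoˡ-≤ l 2≤l)) ⟩
    3 * (m * (l + l)) ≡⟨ solve 2 (λ m l → con 3 :* (m :* (l :+ l)) := con 6 :* m :* l) refl m l ⟩
    6 * m * l         ∎
    where
    open ≤-Reasoning
    open +-*-Solver

  module _ (G : Graph) where

    open Graph G

    nextReach-halves : ∀ {Δ Δ'} {C : Contraction G Δ} → NextReach G C Δ' → Δ' ℚ.≤ Δ ℚ.* ½
    nextReach-halves (inj₁ (_ , refl))                 = ℚ.≤-refl
    nextReach-halves (inj₂ (_ , _ , cheap , _ , refl)) = ℚ.*-monoʳ-≤-nonNeg ½ cheap

    layerSequence-halving : ∀ {Δ₀ Δ C L} → IsLayerSequence G Δ₀ Δ C L → Halving Δ L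
    layerSequence-halving {C = C} (_ , next , _) j j<L = nextReach-halves {C = C j} (next j j<L)

    module _ {Δ} (C : Contraction G Δ) where

      open Contraction C

      inLayer⇒inWindow : ∀ e → InLayer G C e → InWindow (cost e ℚ.* ½) (ℕℚ n ℚ.* cost e) Δ
      inLayer⇒inWindow e (Δ<n·c , c≤2Δ , _) = c/2≤Δ , Δ<n·c
        where
        c/2≤Δ : cost e ℚ.* ½ ℚ.≤ Δ
        c/2≤Δ = begin
          cost e ℚ.* ½      ≤⟨ ℚ.*-monoʳ-≤-nonNeg ½ c≤2Δ ⟩
          ℕℚ 2 ℚ.* Δ ℚ.* ½  ≡⟨ solve 1 (λ Δ → con (ℕℚ 2) :* Δ :* con ½ := Δ) refl Δ ⟩
          Δ                 ∎
          where
          open ℚ.≤-Reasoning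
          open ℚ.+-*-Solver

      layerVertices≤2*layerEdges : layerVertices G C ≤ 2 * layerEdges G C
      layerVertices≤2*layerEdges = countFin-endpoints-≤ (nonIsolated? G C) (inLayer? G C)
        (π ∘ proj₁ ∘ ends) (π ∘ proj₂ ∘ ends) (λ _ nonIsolated → nonIsolated)

      layerSize≤3*layerEdges : layerVertices G C + layerEdges G C ≤ 3 * layerEdges G C
      layerSize≤3*layerEdges = ≤-trans (+-monoˡ-≤ (layerEdges G C) layerVertices≤2*layerEdges)
                                        (≤-reflexive (+-comm (2 * layerEdges G C) (layerEdges G C)))

    edge-layers-≤ : ∀ {Δ₀ Δ C L} → IsLayerSequence G Δ₀ Δ C L → ∀ e → 0ℚ ℚ.≤ cost e →
                    ∑[ i < suc L ] 𝟙 (inLayer? G (C (toℕ i)) e) ≤ suc ⌊log₂ (2 * n) ⌋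
    edge-layers-≤ {Δ = Δ} {C} {L} sequence e 0≤c = begin
      ∑[ i < suc L ] e∈layer i  ≤⟨ ∑-mono-≤ {suc L} {e∈layer} {Δ∈window} e∈layer≤Δ∈window ⟩
      visits c/2 n·c Δ (suc L)  ≤⟨ visits-≤-1+⌊log₂⌋ 0≤c/2 {L} {Δ} (2 * n) halving n·c≤2n·c/2 ⟩
      suc ⌊log₂ (2 * n) ⌋       ∎
      where
      open ≤-Reasoning
      c/2 n·c : ℚ.ℚ
      c/2 = cost e ℚ.* ½
      n·c = ℕℚ n ℚ.* cost e
      e∈layer Δ∈window : Fin (suc L) → ℕ
      e∈layer i = 𝟙 (inLayer? G (C (toℕ i)) e)
      Δ∈window i = 𝟙 (inWindow? c/2 n·c (Δ (toℕ i)))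
      e∈layer≤Δ∈window : ∀ i → e∈layer i ≤ Δ∈window i
      e∈layer≤Δ∈window i =
        𝟙-mono (inLayer⇒inWindow (C (toℕ i)) e) (inLayer? G (C (toℕ i)) e) (inWindow? c/2 n·c (Δ (toℕ i)))
      halving : Halving Δ L
      halving = layerSequence-halving {C = C} sequence
      0≤c/2 : 0ℚ ℚ.≤ c/2
      0≤c/2 = ℚ.*-monoʳ-≤-nonNeg ½ 0≤c
      n·c≤2n·c/2 : n·c ℚ.≤ ℕℚ (2 * n) ℚ.* c/2
      n·c≤2n·c/2 = ℚ.≤-reflexive (sym (ℕℚ[2n]*c/2≡ℕℚn*c n (cost e)))

    totalSize-≤ : .{{NonZero n}} → PositiveCosts G → ∀ {Δ₀ Δ C L} → IsLayerSequence G Δ₀ Δ C L →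
                  totalSize G Δ C L ≤ 3 * (m * (2 + ⌊log₂ n ⌋))
    totalSize-≤ positive {Δ = Δ} {C} {L} sequence = begin
      totalSize G Δ C L                          ≡⟨ cong sum (map-upTo size (suc L)) ⟩
      sum (applyUpTo size (suc L))               ≡⟨ sum-applyUpTo size (suc L) ⟩
      ∑[ i < suc L ] size (toℕ i)                ≤⟨ ∑-mono-≤ {suc L} {size ∘ toℕ} {λ i → 3 * edges (toℕ i)} size≤3*edges ⟩
      ∑[ i < suc L ] (3 * edges (toℕ i))         ≡⟨ *-distribˡ-sum {suc L} 3 (edges ∘ toℕ) ⟨
      3 * ∑[ i < suc L ] edges (toℕ i)           ≡⟨ cong (3 *_) (sum-cong-≗ {suc L} (countFin≡∑𝟙 ∘ inLayer? G ∘ C ∘ toℕ)) ⟩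
      3 * ∑[ i < suc L ] ∑[ e < m ] e∈layer e i  ≡⟨ cong (3 *_) (∑-comm {suc L} (λ i e → e∈layer e i)) ⟩
      3 * ∑[ e < m ] ∑[ i < suc L ] e∈layer e i  ≤⟨ *-monoʳ-≤ 3 (∑-≤-* {m} layers∋e≤) ⟩
      3 * (m * suc ⌊log₂ (2 * n) ⌋)              ≡⟨ cong (λ l → 3 * (m * suc l)) (⌊log₂[2*b]⌋≡1+⌊log₂b⌋ n) ⟩
      3 * (m * (2 + ⌊log₂ n ⌋))                  ∎
      where
      open ≤-Reasoning
      edges size : ℕ → ℕ
      edges i = layerEdges G (C i)
      size i = layerVertices G (C i) + layerEdges G (C i)
      e∈layer : Fin m → Fin (suc L) → ℕ
      e∈layer e i = 𝟙 (inLayer? G (C (toℕ i)) e)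
      size≤3*edges : ∀ i → size (toℕ i) ≤ 3 * edges (toℕ i)
      size≤3*edges i = layerSize≤3*layerEdges (C (toℕ i))
      layers∋e≤ : ∀ e → ∑[ i < suc L ] e∈layer e i ≤ suc ⌊log₂ (2 * n) ⌋
      layers∋e≤ e = edge-layers-≤ {C = C} sequence e (ℚ.<⇒≤ (positive e))

open import Defs
open import Data.Nat using (ℕ; _≤_; _*_; suc; s≤s; z≤n; >-nonZero)
open import Data.Nat.Logarithm using (⌊log₂_⌋; ⌊log₂⌋-mono-≤)
open import Data.Rational using (ℚ; _+_)
open import Data.Fin using (Fin)
open import Data.Product using (Σ; _×_; _,_)
open import Data.Nat.Properties using (≤-trans)
open LayerSizes using (totalSize-≤; 3*[m*[2+l]]≤6*m*l)

lemma1 : Σ ℕ λ K →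
    (G : Graph) → 4 ≤ Graph.n G → Simple G → PositiveCosts G → Connected G →
    (s x y : Fin (Graph.n G)) (dist : Fin (Graph.n G) → ℚ) →
    (∀ v → IsDist G s v (dist v)) → TwoFarthest G dist x y →
    (Δ : ℕ → ℚ) (C : (i : ℕ) → Contraction G (Δ i)) (L : ℕ) →
    IsLayerSequence G (dist x + dist y) Δ C L →
    totalSize G Δ C L ≤ K * Graph.m G * ⌊log₂ Graph.n G ⌋
lemma1 = 6 , λ G 4≤n _ positive _ _ _ _ _ _ _ _ C L sequence →
  ≤-trans (totalSize-≤ G {{>-nonZero (≤-trans (s≤s z≤n) 4≤n)}} positive {C = C} {L} sequence)
          (3*[m*[2+l]]≤6*m*l (Graph.m G) (⌊log₂⌋-mono-≤ 4≤n))
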